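{- Let $k\ge1$, let $\lambda,\mu$ be partitions, fix $n\ge\ell(\lambda)$ with $n>\ell(\mu)$, and let $\sigma$ be a good orientation of $\mathcal{P}_k(\lambda,\mu)$ with reversed rows $r_1<r_2<\cdots<r_m$. Then $|\sigma|=m$ (the number of upward edges) and $\operatorname{inv}(\sigma)=\operatorname{ht}(\sigma)$.
   Context: $\operatorname{Pet}_k(\lambda,\mu)$ is the $n\times n$ matrix with $(i,j)$ entry $1$ if $0\le\lambda_i-i-\mu_j+j<k$, else $0$. Set $\mu_0=+\infty$; for $0\le m\le n-1$ let $I_m=\{t\in\mathbb Z:m-\mu_m\le t<m+1-\mu_{m+1}\}$ and $I_n=\{t\ge n\}$. For row $i$ let $a_i,b_i$ be such that $i-\lambda_i-1\in I_{a_i}$, $i-\lambda_i-1+k\in I_{b_i}$; row $i$ of $\operatorname{Pet}_k(\lambda,\mu)$ has ones exactly in positions $a_i+1,\dots,b_i$. $\mathcal{P}_k(\lambda,\mu)$ is the multigraph on $\{0,\dots,n\}$ with an edge $\{a_i,b_i\}$ for each row $i$. An orientation $\sigma$ chooses for each row either unreversed $(c_i,d_i)=(a_i,b_i)$ (a downward edge) or reversed $(c_i,d_i)=(b_i,a_i)$ (an upward edge), distinct choices even if $a_i=b_i$; it is good if $(c_1,\dots,c_n)$ is a permutation of $\{0,\dots,n-1\}$; $|\sigma|$ is the number of reversed rows and $\operatorname{inv}(\sigma)=\#\{(r,s):r<s,\ c_r>c_s\}$. The Maya diagram of a partition $\kappa$ is the sequence $(x_p)_{p\in\mathbb Z}$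 with $x_p=1$ if $p=\kappa_j-j+1$ for some $j\ge1$ and $x_p=0$ otherwise. Height of $\sigma$: put $\gamma_j=r_j-\lambda_{r_j}-1+k$ for $j=1,\dots,m$; let $x^{(m)}$ be the Maya diagram of $\lambda$ and, for $j=m,m-1,\dots,1$, let $x^{(j-1)}$ be obtained from $x^{(j)}$ by interchanging its entries at positions $-\gamma_j$ and $-\gamma_j+k$. Then $\operatorname{ht}(\sigma)=\sum_{j=1}^m\#\{p:-\gamma_j<p<-\gamma_j+k,\ x^{(j)}_p=1\}$. -}

module Defs where

open import Data.Nat as ℕ using (ℕ; zero; suc; _∸_)
open import Data.Integer as ℤ using (ℤ; +_; -_; _-_; _<_; _≤_; _+_)
open import Data.Bool using (Bool; true; false; if_then_else_)
open import Data.Fin using (Fin; toℕ)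
open import Data.List as List using (List; []; _∷_; length; filter; applyUpTo; allFin; reverse)
open import Data.List.Relation.Unary.All using (All)
open import Data.List.Relation.Unary.Linked using (Linked)
open import Data.Product using (Σ; ∃; _×_; _,_)
open import Data.Empty using (⊥)
open import Data.Nat.ListAction using (sum)
open import Relation.Nullary using (yes; no)
open import Relation.Binary.PropositionalEquality using (_≡_)
open import Relation.Nullary.Decidable using (⌊_⌋)
import Data.Fin.Properties as FinP
import Data.Nat.Properties as ℕP

IsPartition : List ℕ → Set
IsPartition xs = All (ℕ._<_ 0) xs × Linked ℕ._≥_ xs

ℓ : List ℕ → ℕ
ℓ = length

-- part xs j = λ_j  (1-indexed; λ_j = 0 for j > ℓ(λ); the value at j = 0 is never used)
part : List ℕ → ℕ → ℕ
part []       _             = 0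
part (x ∷ xs) zero          = 0
part (x ∷ xs) (suc zero)    = x
part (x ∷ xs) (suc (suc j)) = part xs (suc j)

-- The intervals I_m (with μ₀ = +∞, and I_n = {t ≥ n}).

InI : List ℕ → ℕ → ℕ → ℤ → Set
InI μ n zero    t = t < + 1 - + part μ 1
InI μ n (suc m) t with suc m ℕ.<? n | suc m ℕ.≟ n
... | yes _ | _ =
      (+ suc m - + part μ (suc m) ≤ t) × (t < + suc (suc m) - + part μ (suc (suc m)))
... | no _ | yes _ = + n ≤ t
... | no _ | no _ = ⊥

-- Rows are indexed by i : Fin n, standing for the row number toℕ i + 1.

row : {n : ℕ} → Fin n → ℕ
row i = suc (toℕ i)

rowStart : List ℕ → {n : ℕ} → Fin n → ℤ
rowStart lam i = + row i - + part lam (row i) - + 1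

-- An orientation: σ i = true means row i is reversed.
Orientation : ℕ → Set
Orientation n = Fin n → Bool

cOf : {n : ℕ} → (a b : Fin n → ℕ) → Orientation n → Fin n → ℕ
cOf a b σ i = if σ i then b i else a i

size : {n : ℕ} → Orientation n → ℕ
size {n} σ = sum (List.map (λ i → if σ i then 1 else 0) (allFin n))

reversedRows : {n : ℕ} → Orientation n → List (Fin n)
reversedRows {n} σ = filter (λ i → σ i Data.Bool.≟ true) (allFin n)

inv : {n : ℕ} → (Fin n → ℕ) → ℕ
inv {n} c = sum (List.map (λ r → sum (List.map (λ s →
              if ⌊ r Data.Fin.<? s ⌋ then (if ⌊ c s ℕ.<? c r ⌋ then 1 else 0) else 0)
              (allFin n))) (allFin n))

MayaOne : List ℕ → ℤ → Set
MayaOne κ p = Σ ℕ λ j → (1 ℕ.≤ j) × (p ≡ + part κ j - + j + + 1)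

swapAt : (ℤ → Bool) → ℤ → ℤ → ℤ → Bool
swapAt x u v p with p ℤ.≟ u | p ℤ.≟ v
... | yes _ | _ = x v
... | no _ | yes _ = x u
... | no _ | no _ = x p

-- #{p : -γ < p < -γ + k, x_p = 1}, i.e. p = -γ + t for t = 1, …, k-1
window : ℕ → (ℤ → Bool) → ℤ → ℕ
window k x γ = sum (List.map (λ t → if x (- γ ℤ.+ + t) then 1 else 0)
                                   (applyUpTo suc (k ∸ 1)))

-- Given [γ_m, γ_{m-1}, …, γ_1] and x = x^{(m)}, returns
-- Σ_{j} #{p : -γ_j < p < -γ_j+k, x^{(j)}_p = 1},
-- where x^{(j-1)} = x^{(j)} with entries at -γ_j and -γ_j+k interchanged.
htAux : ℕ → List ℤ → (ℤ → Bool) → ℕ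
htAux k []       x = 0
htAux k (γ ∷ γs) x = window k x γ ℕ.+ htAux k γs (swapAt x (- γ) (- γ ℤ.+ + k))

gammas : List ℕ → ℕ → {n : ℕ} → Orientation n → List ℤ
gammas lam k σ = List.map (λ r → rowStart lam r ℤ.+ + k) (reversedRows σ)

-- ht(σ), given x the Maya diagram of λ (as a Bool-valued function on ℤ)
ht : List ℕ → ℕ → (ℤ → Bool) → {n : ℕ} → Orientation n → ℕ
ht lam k x σ = htAux k (reverse (gammas lam k σ)) x

-- Put L i = i - λ_i - 1, which is strictly increasing, and let f i be L i, or L i + k when row i is
-- reversed, so that c i is the index of the interval I_{c i} containing f i. The intervals are
-- consecutive, so c is monotone in f, and c is a permutation; hence c and f have the same inversions,
-- and an unreversed row r starts none, since f s ≥ L s > L r = f r for s > r.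
-- The Maya diagram of λ has its ones at the positions -L i and at all positions ≤ -n. Process the
-- reversed rows from the last to the first: the swap for row r moves the one at -γ_r + k = -L r to
-- -γ_r = -f r, and just before it the ones strictly between -γ_r and -γ_r + k are exactly at the -f s
-- for the rows s > r with f s < f r. So the r-th term of ht(σ) counts the inversions (r, s).
module Submission where

open import Defs
open import Data.Nat using (ℕ; _≤_; _<_)
open import Data.Integer using (ℤ; +_; _+_)
open import Data.Bool using (Bool; true)
open import Data.Fin using (Fin)
open import Data.List using (List; length; map; allFin; upTo)
open import Data.List.Relation.Binary.Permutation.Propositional using (_↭_)
open import Data.Product using (_×_)
open import Function.Bundles using (_⇔_)
open import Relation.Binary.PropositionalEquality using (_≡_)

open import Data.Nat as ℕ using (zero; suc; _∸_; z≤n; s≤s)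
import Data.Nat.Properties as ℕP
open import Data.Nat.ListAction using (sum)
open import Data.Nat.ListAction.Properties using (sum-↭)
import Data.Nat.Tactic.RingSolver as ℕ-Solver
open import Data.Integer using (-_; _-_; +<+; +≤+; ∣_∣)
  renaming (_<_ to _<ℤ_; _≤_ to _≤ℤ_; _<?_ to _<ℤ?_; _≟_ to _≟ℤ_)
import Data.Integer.Properties as ℤP
import Data.Integer.Tactic.RingSolver as ℤ-Solver
open import Data.Bool using (false; if_then_else_)
open import Data.Fin as Fin using (toℕ; fromℕ<)
import Data.Fin.Properties as FinP
open import Data.List using ([]; _∷_; filter; reverse; applyUpTo)
import Data.List.Properties as List
open import Data.List.Membership.Propositional using (_∈_)
open import Data.List.Membership.Propositional.Properties
  using (∈-map⁺; ∈-upTo⁻; ∈-applyUpTo⁺; ∈-applyUpTo⁻; ∈-allFin; ∈-filter⁺; ∈-filter⁻)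
open import Data.List.Relation.Unary.Any using (here; there)
import Data.List.Relation.Unary.All as All
open import Data.List.Relation.Unary.AllPairs using (AllPairs; []; _∷_)
import Data.List.Relation.Unary.AllPairs as AllPairs
import Data.List.Relation.Unary.AllPairs.Properties as AllPairsₚ
open import Data.List.Relation.Unary.Linked using (Linked; []; [-]; _∷_)
open import Data.List.Relation.Unary.Unique.Propositional using (Unique)
import Data.List.Relation.Unary.Unique.Propositional.Properties as Unique
open import Data.List.Relation.Binary.Permutation.Propositional using (↭-sym; ↭⇒↭ₛ)
open import Data.List.Relation.Binary.Permutation.Propositional.Properties
  using (All-resp-↭; ∈-resp-↭; ↭-reverse; map⁺)
open import Data.List.Relation.Binary.Permutation.Setoid.Properties (Relation.Binary.PropositionalEquality.setoid ℕ)
  using (Unique-resp-↭)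
open import Data.Product using (Σ; _,_; proj₁; proj₂)
open import Data.Sum using (_⊎_; inj₁; inj₂)
open import Data.Empty using (⊥-elim)
open import Function using (_∘_; flip)
open import Function.Bundles using (mk⇔; Equivalence)
open import Function.Construct.Composition using (_⇔-∘_)
open import Function.Construct.Symmetry using (⇔-sym)
open import Relation.Binary using (tri<; tri≈; tri>)
open import Relation.Binary.PropositionalEquality
  using (_≢_; refl; sym; trans; cong; cong₂; subst; subst₂; module ≡-Reasoning)
open import Relation.Nullary using (Dec; yes; no; ¬_)
open import Relation.Nullary.Decidable using (⌊_⌋)

private
  variable
    A B : Set

when : ∀ {P : Set} → Dec P → ℕ → ℕ
when d m = if ⌊ d ⌋ then m else 0

𝟙 : ∀ {P : Set} → Dec P → ℕ
𝟙 d = when d 1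

when-yes : ∀ {P : Set} (d : Dec P) {m} → P → when d m ≡ m
when-yes (yes _) _ = refl
when-yes (no ¬p) p = ⊥-elim (¬p p)

when-no : ∀ {P : Set} (d : Dec P) {m} → ¬ P → when d m ≡ 0
when-no (yes p) ¬p = ⊥-elim (¬p p)
when-no (no _) _ = refl

when-zero : ∀ {P : Set} (d : Dec P) {m} → (P → m ≡ 0) → when d m ≡ 0
when-zero (yes p) m≡0 = m≡0 p
when-zero (no _)  _   = refl

when-cong : ∀ {P : Set} (d : Dec P) {m m'} → (P → m ≡ m') → when d m ≡ when d m'
when-cong (yes p) m≡m' = m≡m' p
when-cong (no _)  _    = refl

𝟙-resp-⇔ : ∀ {P Q : Set} (p? : Dec P) (q? : Dec Q) → P ⇔ Q → 𝟙 p? ≡ 𝟙 q?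
𝟙-resp-⇔ (yes p) q? P⇔Q = sym (when-yes q? (Equivalence.to P⇔Q p))
𝟙-resp-⇔ (no ¬p) q? P⇔Q = sym (when-no q? (¬p ∘ Equivalence.from P⇔Q))

sum-map-cong : ∀ {xs : List A} {g h : A → ℕ} → (∀ {x} → x ∈ xs → g x ≡ h x) →
  sum (map g xs) ≡ sum (map h xs)
sum-map-cong {xs = []}     _ = refl
sum-map-cong {xs = x ∷ xs} e = cong₂ ℕ._+_ (e (here refl)) (sum-map-cong (e ∘ there))

sum-map-zero : ∀ {xs : List A} {h : A → ℕ} → (∀ {x} → x ∈ xs → h x ≡ 0) → sum (map h xs) ≡ 0
sum-map-zero {xs = []}     _ = refl
sum-map-zero {xs = x ∷ xs} e rewrite e (here refl) = sum-map-zero (e ∘ there)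

sum-map-single : ∀ {xs : List A} {h : A → ℕ} {x} → Unique xs → x ∈ xs → h x ≡ 1 →
  (∀ {y} → y ∈ xs → y ≢ x → h y ≡ 0) → sum (map h xs) ≡ 1
sum-map-single (x∉ ∷ _) (here refl) hx≡1 others rewrite hx≡1 =
  cong suc (sum-map-zero (λ y∈ → others (there y∈) (λ y≡x → All.lookup x∉ y∈ (sym y≡x))))
sum-map-single (y∉ ∷ u) (there x∈) hx≡1 others rewrite others (here refl) (λ y≡x → All.lookup y∉ x∈ y≡x) =
  sum-map-single u x∈ hx≡1 (others ∘ there)

sum-map-when : ∀ {P : Set} (d : Dec P) (xs : List A) (h : A → ℕ) →
  sum (map (λ x → when d (h x)) xs) ≡ when d (sum (map h xs))
sum-map-when (yes _) xs h = refl
sum-map-when (no _)  xs h = sum-map-zero {xs = xs} λ _ → refl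

sum-map-+ : ∀ (xs : List A) (g h : A → ℕ) →
  sum (map (λ x → g x ℕ.+ h x) xs) ≡ sum (map g xs) ℕ.+ sum (map h xs)
sum-map-+ []       g h = refl
sum-map-+ (x ∷ xs) g h = trans (cong (g x ℕ.+ h x ℕ.+_) (sum-map-+ xs g h)) (interchange (g x) (h x) _ _)
  where
    interchange : ∀ a b c d → (a ℕ.+ b) ℕ.+ (c ℕ.+ d) ≡ (a ℕ.+ c) ℕ.+ (b ℕ.+ d)
    interchange = ℕ-Solver.solve-∀

sum-map-exchange : ∀ (xs : List A) (ys : List B) (h : A → B → ℕ) →
  sum (map (λ x → sum (map (h x) ys)) xs) ≡ sum (map (λ y → sum (map (λ x → h x y) xs)) ys)
sum-map-exchange []       ys h = sym (sum-map-zero {xs = ys} (λ _ → refl))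
sum-map-exchange (x ∷ xs) ys h =
  trans (cong (sum (map (h x) ys) ℕ.+_) (sum-map-exchange xs ys h))
        (sym (sum-map-+ ys (h x) (λ y → sum (map (λ x → h x y) xs))))

sum-map-filter : ∀ (σ : A → Bool) (h : A → ℕ) (xs : List A) → (∀ {x} → x ∈ xs → σ x ≡ false → h x ≡ 0) →
  sum (map h (filter (λ x → σ x Data.Bool.≟ true) xs)) ≡ sum (map h xs)
sum-map-filter σ h []       _      = refl
sum-map-filter σ h (x ∷ xs) vanish with σ x in σx
... | true  = cong (h x ℕ.+_) (sum-map-filter σ h xs (vanish ∘ there))
... | false rewrite vanish (here refl) σx = sum-map-filter σ h xs (vanish ∘ there)

count-true≡length-filter : ∀ (σ : A → Bool) (xs : List A) →
  sum (map (λ x → if σ x then 1 else 0) xs) ≡ length (filter (λ x → σ x Data.Bool.≟ true) xs)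
count-true≡length-filter σ [] = refl
count-true≡length-filter σ (x ∷ xs) with σ x
... | true  = cong suc (count-true≡length-filter σ xs)
... | false = count-true≡length-filter σ xs

Unique-map⇒injective : ∀ {f : A → B} {xs} → Unique (map f xs) →
  ∀ {x y} → x ∈ xs → y ∈ xs → f x ≡ f y → x ≡ y
Unique-map⇒injective {xs = _ ∷ _} _ (here refl) (here refl) _ = refl
Unique-map⇒injective {f = f} (fx∉ ∷ _) (here refl) (there y∈) e = ⊥-elim (All.lookup fx∉ (∈-map⁺ f y∈) e)
Unique-map⇒injective {f = f} (fy∉ ∷ _) (there x∈) (here refl) e = ⊥-elim (All.lookup fy∉ (∈-map⁺ f x∈) (sym e))
Unique-map⇒injective (_ ∷ u) (there x∈) (there y∈) e = Unique-map⇒injective u x∈ y∈ e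

AllPairs-reverse : ∀ {R : A → A → Set} {xs} → AllPairs R xs → AllPairs (flip R) (reverse xs)
AllPairs-reverse {xs = []} [] = []
AllPairs-reverse {xs = x ∷ xs} (x≺ ∷ p) rewrite List.unfold-reverse x xs =
  AllPairsₚ.++⁺ (AllPairs-reverse p) (All.[] ∷ [])
    (All-resp-↭ (↭-sym (↭-reverse xs)) (All.map (All._∷ All.[]) x≺))

i<i+n : ∀ i {n} → 0 < n → i <ℤ i + + n
i<i+n i 0<n = subst (_<ℤ i + + _) (ℤP.+-identityʳ i) (ℤP.+-monoʳ-< i (+<+ 0<n))

0<j-i : ∀ {i j} → i <ℤ j → + 0 <ℤ j - i
0<j-i {i} {j} i<j = subst (_<ℤ j - i) (ℤP.+-inverseʳ i) (ℤP.+-monoˡ-< (- i) i<j)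

module _ {X : Set} {g : X → ℕ} {h : X → ℤ}
  (g-monotone : ∀ {x y} → h x ≤ℤ h y → g x ≤ g y) (g-injective : ∀ {x y} → g x ≡ g y → x ≡ y) where

  monotone-injective⇒injective : ∀ {x y} → h x ≡ h y → x ≡ y
  monotone-injective⇒injective hx≡hy =
    g-injective (ℕP.≤-antisym (g-monotone (ℤP.≤-reflexive hx≡hy)) (g-monotone (ℤP.≤-reflexive (sym hx≡hy))))

  monotone-injective⇒<⇔< : ∀ x y → g x < g y ⇔ h x <ℤ h y
  monotone-injective⇒<⇔< x y = mk⇔
    (λ gx<gy → ℤP.≰⇒> (λ hy≤hx → ℕP.<⇒≱ gx<gy (g-monotone hy≤hx)))
    (λ hx<hy → ℕP.≤∧≢⇒< (g-monotone (ℤP.<⇒≤ hx<hy)) (λ gx≡gy → ℤP.<-irrefl (cong h (g-injective gx≡gy)) hx<hy))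

offsets : ℕ → List ℕ
offsets k = applyUpTo suc (k ∸ 1)

∈-offsets⁻ : ∀ {k u} → u ∈ offsets k → 1 ≤ u × u < k
∈-offsets⁻ {suc k} u∈ with ∈-applyUpTo⁻ suc u∈
... | v , v<k , refl = s≤s z≤n , s≤s v<k

∈-offsets⁺ : ∀ {k u} → 1 ≤ u → u < k → u ∈ offsets k
∈-offsets⁺ {suc k} {suc v} _ (s≤s v<k) = ∈-applyUpTo⁺ suc v<k

offsets-unique : ∀ k → Unique (offsets k)
offsets-unique k = Unique.applyUpTo⁺₁ suc (k ∸ 1) (λ i<j _ → ℕP.<⇒≢ (s≤s i<j))

offsets-hit : ∀ k (a b : ℤ) → b <ℤ a + + k →
  sum (map (λ u → 𝟙 (a + + u ≟ℤ b)) (offsets k)) ≡ 𝟙 (a <ℤ? b)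
offsets-hit k a b b<a+k with a <ℤ? b
... | no a≮b = sum-map-zero {xs = offsets k} λ {u} u∈ → when-no (a + + u ≟ℤ b)
        λ a+u≡b → a≮b (subst (a <ℤ_) a+u≡b (i<i+n a (proj₁ (∈-offsets⁻ {k} u∈))))
... | yes a<b = sum-map-single (offsets-unique k) (∈-offsets⁺ 1≤u₀ u₀<k) (when-yes (a + + u₀ ≟ℤ b) hit) miss
  where
    u₀ : ℕ
    u₀ = ∣ b - a ∣
    +u₀≡b-a : + u₀ ≡ b - a
    +u₀≡b-a = ℤP.0≤i⇒+∣i∣≡i (ℤP.<⇒≤ (0<j-i a<b))
    1≤u₀ : 1 ≤ u₀
    1≤u₀ = ℤP.drop‿+<+ (subst (+ 0 <ℤ_) (sym +u₀≡b-a) (0<j-i a<b))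
    a+k-a≡k : ∀ a k → a + k - a ≡ k
    a+k-a≡k = ℤ-Solver.solve-∀
    u₀<k : u₀ < k
    u₀<k = ℤP.drop‿+<+ (subst₂ _<ℤ_ (sym +u₀≡b-a) (a+k-a≡k a (+ k)) (ℤP.+-monoˡ-< (- a) b<a+k))
    a+[b-a]≡b : ∀ a b → a + (b - a) ≡ b
    a+[b-a]≡b = ℤ-Solver.solve-∀
    hit : a + + u₀ ≡ b
    hit = trans (cong (λ x → a + x) +u₀≡b-a) (a+[b-a]≡b a b)
    x≡[a+x]-a : ∀ a x → x ≡ (a + x) - a
    x≡[a+x]-a = ℤ-Solver.solve-∀
    miss : ∀ {u} → u ∈ offsets k → u ≢ u₀ → 𝟙 (a + + u ≟ℤ b) ≡ 0
    miss {u} _ u≢u₀ = when-no (a + + u ≟ℤ b) λ a+u≡b →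
      u≢u₀ (ℤP.+-injective (trans (x≡[a+x]-a a (+ u)) (trans (cong (_- a) a+u≡b) (sym +u₀≡b-a))))

part-beyond : ∀ κ {j} → length κ < j → part κ j ≡ 0
part-beyond []       _ = refl
part-beyond (x ∷ κ) {suc zero}    (s≤s ())
part-beyond (x ∷ κ) {suc (suc j)} (s≤s ℓ<j) = part-beyond κ ℓ<j

part-antitone : ∀ {κ} → Linked ℕ._≥_ κ → ∀ {i j} → i ≤ j → part κ (suc j) ≤ part κ (suc i)
part-antitone []  _ = z≤n
part-antitone [-] {zero} {zero} _ = ℕP.≤-refl
part-antitone [-] {_} {suc _} _ = z≤n
part-antitone (_ ∷ _)   {zero} {zero} _ = ℕP.≤-refl
part-antitone (x≥y ∷ l) {zero} {suc j} _ = ℕP.≤-trans (part-antitone l {j = j} z≤n) x≥y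
part-antitone (_ ∷ l)   {suc i} {suc j} (s≤s i≤j) = part-antitone l i≤j

rowStart-strict : ∀ {κ} → Linked ℕ._≥_ κ → ∀ {n} {i j : Fin n} → toℕ i < toℕ j → rowStart κ i <ℤ rowStart κ j
rowStart-strict l i<j = ℤP.+-monoˡ-< (- + 1)
  (ℤP.+-mono-<-≤ (+<+ (s≤s i<j)) (ℤP.neg-mono-≤ (+≤+ (part-antitone l (ℕP.<⇒≤ i<j)))))

-- Row i : Fin n is row i + 1 of the paper; the parts of κ beyond n are 0 and give the positions ≤ -n.
MayaOne⇔rowStart : ∀ κ {n} → length κ ≤ n → ∀ p →
  MayaOne κ p ⇔ ((Σ (Fin n) λ i → p ≡ - rowStart κ i) ⊎ p ≤ℤ - + n)
MayaOne⇔rowStart κ {n} ℓκ≤n p = mk⇔ to from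
  where
    neg-rowStart : ∀ j → + part κ (suc j) - + suc j + + 1 ≡ - (+ suc j - + part κ (suc j) - + 1)
    neg-rowStart j = solve (+ suc j) (+ part κ (suc j))
      where solve : ∀ J P → P - J + + 1 ≡ - (J - P - + 1)
            solve = ℤ-Solver.solve-∀
    empty-part : ∀ {j} → n ≤ j → + part κ (suc j) - + suc j + + 1 ≡ - + j
    empty-part {j} n≤j rewrite part-beyond κ (ℕP.≤-<-trans ℓκ≤n (s≤s n≤j)) = solve (+ j)
      where solve : ∀ J → + 0 - (+ 1 + J) + + 1 ≡ - J
            solve = ℤ-Solver.solve-∀
    to : MayaOne κ p → (Σ (Fin n) λ i → p ≡ - rowStart κ i) ⊎ p ≤ℤ - + n
    to (suc j , _ , p≡) with suc j ℕ.≤? n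
    ... | yes j<n = inj₁ (fromℕ< j<n , trans p≡ (subst (λ m → _ ≡ - (+ suc m - + part κ (suc m) - + 1))
                      (sym (FinP.toℕ-fromℕ< j<n)) (neg-rowStart j)))
    ... | no j≮n = inj₂ (subst (_≤ℤ - + n) (sym (trans p≡ (empty-part n≤j))) (ℤP.neg-mono-≤ (+≤+ n≤j)))
      where n≤j = ℕP.≤-pred (ℕP.≰⇒> j≮n)
    from : (Σ (Fin n) λ i → p ≡ - rowStart κ i) ⊎ p ≤ℤ - + n → MayaOne κ p
    from (inj₁ (i , p≡)) = suc (toℕ i) , s≤s z≤n , trans p≡ (sym (neg-rowStart (toℕ i)))
    from (inj₂ p≤-n) = suc j , s≤s z≤n , sym (trans (empty-part n≤j) (trans (cong -_ +j≡-p) (ℤP.neg-involutive p)))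
      where
        n≤-p : + n ≤ℤ - p
        n≤-p = subst (_≤ℤ - p) (ℤP.neg-involutive (+ n)) (ℤP.neg-mono-≤ p≤-n)
        j : ℕ
        j = ∣ - p ∣
        +j≡-p : + j ≡ - p
        +j≡-p = ℤP.0≤i⇒+∣i∣≡i (ℤP.≤-trans (+≤+ z≤n) n≤-p)
        n≤j : n ≤ j
        n≤j = ℤP.drop‿+≤+ (subst (+ n ≤ℤ_) (sym +j≡-p) n≤-p)

-- For 0 < m < n, I_m is the interval [lowerEnd μ m, lowerEnd μ (m + 1)).
lowerEnd : List ℕ → ℕ → ℤ
lowerEnd μ m = + m - + part μ m

lowerEnd-mono : ∀ {μ} → Linked ℕ._≥_ μ → ∀ {j m} → j ≤ m → lowerEnd μ (suc j) ≤ℤ lowerEnd μ (suc m)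
lowerEnd-mono l j≤m = ℤP.+-mono-≤ (+≤+ (s≤s j≤m)) (ℤP.neg-mono-≤ (+≤+ (part-antitone l j≤m)))

InI-index≤n : ∀ {μ n m t} → InI μ n m t → m ≤ n
InI-index≤n {m = zero} _ = z≤n
InI-index≤n {μ} {n} {suc m} {t} I with suc m ℕ.<? n | suc m ℕ.≟ n
... | yes m<n | _     = ℕP.<⇒≤ m<n
... | no _    | yes e = ℕP.≤-reflexive e

InI-upper : ∀ {μ n m t} → m < n → InI μ n m t → t <ℤ lowerEnd μ (suc m)
InI-upper {m = zero} _ I = I
InI-upper {μ} {n} {suc m} {t} m<n I with suc m ℕ.<? n
... | yes _   = proj₂ I
... | no m≮n = ⊥-elim (m≮n m<n)

InI-lower : ∀ {μ n m t} → InI μ n (suc m) t → lowerEnd μ (suc m) ≤ℤ t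
InI-lower {μ} {n} {m} {t} I with suc m ℕ.<? n | suc m ℕ.≟ n
... | yes _ | _      = proj₁ I
... | no _  | yes refl = ℤP.≤-trans (ℤP.i-j≤i (+ n) (+ part μ n)) I

InI-index-mono : ∀ {μ n m m' t t'} → Linked ℕ._≥_ μ →
  InI μ n m t → InI μ n m' t' → t ≤ℤ t' → m ≤ m'
InI-index-mono {m = zero} _ _ _ _ = z≤n
InI-index-mono {μ} {n} {suc m} {m'} {t} {t'} l I I' t≤t' with suc m ℕ.≤? m'
... | yes m<m' = m<m'
... | no m≮m' = ⊥-elim (ℤP.<⇒≱ t'<t t≤t')
  where
    open ℤP.≤-Reasoning
    m'≤m : m' ≤ m
    m'≤m = ℕP.≤-pred (ℕP.≰⇒> m≮m')
    t'<t : t' <ℤ t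
    t'<t = begin-strict
      t'                 <⟨ InI-upper (ℕP.≤-<-trans m'≤m (InI-index≤n I)) I' ⟩
      lowerEnd μ (suc m') ≤⟨ lowerEnd-mono l m'≤m ⟩
      lowerEnd μ (suc m)  ≤⟨ InI-lower I ⟩
      t                  ∎

InI-<n : ∀ {μ n m t} → m < n → InI μ n m t → t <ℤ + n
InI-<n {μ} {n} {m} {t} m<n I = begin-strict
  t                  <⟨ InI-upper m<n I ⟩
  lowerEnd μ (suc m) ≤⟨ ℤP.i-j≤i (+ suc m) (+ part μ (suc m)) ⟩
  + suc m            ≤⟨ +≤+ m<n ⟩
  + n                ∎
  where open ℤP.≤-Reasoning

laterSmaller : ∀ {n} → (Fin n → ℤ) → Fin n → ℕ
laterSmaller {n} g r = sum (map (λ s → when (r Fin.<? s) (𝟙 (g s <ℤ? g r))) (allFin n))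

inversionsℤ : ∀ {n} → (Fin n → ℤ) → ℕ
inversionsℤ {n} g = sum (map (laterSmaller g) (allFin n))

inv≡inversionsℤ : ∀ {n} (c : Fin n → ℕ) (g : Fin n → ℤ) → (∀ i j → c i < c j ⇔ g i <ℤ g j) →
  inv c ≡ inversionsℤ g
inv≡inversionsℤ {n} c g same-order = sum-map-cong {xs = allFin n} λ {r} _ → sum-map-cong {xs = allFin n} λ {s} _ →
  cong (when (r Fin.<? s)) (𝟙-resp-⇔ (c s ℕ.<? c r) (g s <ℤ? g r) (same-order s r))

module MayaSweep {n k : ℕ} (1≤k : 1 ≤ k) (L : Fin n → ℤ)
  (L-strict : ∀ {i j} → toℕ i < toℕ j → L i <ℤ L j) (σ : Orientation n) where

  f : Fin n → ℤ
  f i = if σ i then L i + + k else L i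

  γ : Fin n → ℤ
  γ r = L r + + k

  f-unreversed : ∀ {i} → σ i ≡ false → f i ≡ L i
  f-unreversed {i} σi≡false rewrite σi≡false = refl

  f-reversed : ∀ {i} → σ i ≡ true → f i ≡ γ i
  f-reversed {i} σi≡true rewrite σi≡true = refl

  L<γ : ∀ i → L i <ℤ γ i
  L<γ i = i<i+n (L i) 1≤k

  L≤f : ∀ i → L i ≤ℤ f i
  L≤f i with σ i
  ... | true  = ℤP.<⇒≤ (L<γ i)
  ... | false = ℤP.≤-refl

  L<later-f : ∀ {r s} → toℕ r < toℕ s → L r <ℤ f s
  L<later-f {s = s} r<s = ℤP.<-≤-trans (L-strict r<s) (L≤f s)

  -γ+k≡-L : ∀ r → - γ r + + k ≡ - L r
  -γ+k≡-L r = solve (L r) (+ k)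
    where solve : ∀ L K → - (L + K) + K ≡ - L
          solve = ℤ-Solver.solve-∀

  laterSmaller-unreversed : ∀ {r} → σ r ≡ false → laterSmaller f r ≡ 0
  laterSmaller-unreversed {r} σr≡false = sum-map-zero {xs = allFin n} λ {s} _ →
    when-zero (r Fin.<? s) λ r<s → when-no (f s <ℤ? f r) λ fs<fr →
      ℤP.<-asym fs<fr (subst (_<ℤ f s) (sym (f-unreversed σr≡false)) (L<later-f r<s))

  module _ (f-injective : ∀ {i j} → f i ≡ f j → i ≡ j) (f<n : ∀ i → f i <ℤ + n) where

    -- The ones of x^{(j)} once the reversed rows ≥ t have been swapped: row i sits at - L i before its swap, at - f i after.
    data Occupied (t : ℕ) (p : ℤ) : Set where
      unmoved : ∀ i → toℕ i < t → p ≡ - L i → Occupied t p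
      moved   : ∀ i → t ≤ toℕ i → p ≡ - f i → Occupied t p
      deep    : p ≤ℤ - + n → Occupied t p

    Tracks : ℕ → (ℤ → Bool) → Set
    Tracks t y = ∀ p → y p ≡ true ⇔ Occupied t p

    UnreversedBetween : Fin n → ℕ → Set
    UnreversedBetween r t = ∀ i → toℕ r < toℕ i → toℕ i < t → σ i ≡ false

    Occupied-initial : ∀ p → Occupied n p ⇔ ((Σ (Fin n) λ i → p ≡ - L i) ⊎ p ≤ℤ - + n)
    Occupied-initial p = mk⇔ to (λ { (inj₁ (i , p≡)) → unmoved i (FinP.toℕ<n i) p≡ ; (inj₂ p≤-n) → deep p≤-n })
      where
        to : Occupied n p → (Σ (Fin n) λ i → p ≡ - L i) ⊎ p ≤ℤ - + n
        to (unmoved i _ p≡) = inj₁ (i , p≡)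
        to (moved i n≤i _)  = ⊥-elim (ℕP.<⇒≱ (FinP.toℕ<n i) n≤i)
        to (deep p≤-n)      = inj₂ p≤-n

    -f-injective : ∀ {i j} → - f i ≡ - f j → i ≡ j
    -f-injective = f-injective ∘ ℤP.neg-injective

    module Swap {t y r} (tracks : Tracks t y) (r<t : toℕ r < t) (σr : σ r ≡ true)
                (between : UnreversedBetween r t) where

      f≡L-between : ∀ {i} → toℕ r < toℕ i → toℕ i < t → f i ≡ L i
      f≡L-between {i} r<i i<t = f-unreversed (between i r<i i<t)

      -n<-γ : - + n <ℤ - γ r
      -n<-γ = ℤP.neg-mono-< (subst (_<ℤ + n) (f-reversed σr) (f<n r))

      later-occupied : ∀ {s} → toℕ r < toℕ s → Occupied t (- f s)
      later-occupied {s} r<s with toℕ s ℕ.<? t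
      ... | yes s<t = unmoved s s<t (cong -_ (f≡L-between r<s s<t))
      ... | no s≮t  = moved s (ℕP.≮⇒≥ s≮t) refl

      window-occupant : ∀ {p} → Occupied t p → - γ r <ℤ p → p <ℤ - L r →
                        Σ (Fin n) λ s → toℕ r < toℕ s × p ≡ - f s
      window-occupant (unmoved i i<t p≡) _ p<-Lr with FinP.<-cmp i r
      ... | tri< i<r _ _ = ⊥-elim (ℤP.<-asym p<-Lr (subst (- L r <ℤ_) (sym p≡) (ℤP.neg-mono-< (L-strict i<r))))
      ... | tri≈ _ refl _ = ⊥-elim (ℤP.<-irrefl p≡ p<-Lr)
      ... | tri> _ _ r<i = i , r<i , trans p≡ (cong -_ (sym (f≡L-between r<i i<t)))
      window-occupant (moved i t≤i p≡) _ _ = i , ℕP.<-≤-trans r<t t≤i , p≡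
      window-occupant (deep p≤-n) -γ<p _ = ⊥-elim (ℤP.<⇒≱ (ℤP.<-trans -n<-γ -γ<p) p≤-n)

      occupies : Fin n → ℕ → ℕ
      occupies s u = when (r Fin.<? s) (𝟙 (- γ r + + u ≟ℤ - f s))

      window-above-γ : ∀ {u} → u ∈ offsets k → - γ r <ℤ - γ r + + u
      window-above-γ u∈ = i<i+n (- γ r) (proj₁ (∈-offsets⁻ {k} u∈))

      window-below-L : ∀ {u} → u ∈ offsets k → - γ r + + u <ℤ - L r
      window-below-L {u} u∈ =
        subst (- γ r + + u <ℤ_) (-γ+k≡-L r) (ℤP.+-monoʳ-< (- γ r) (+<+ (proj₂ (∈-offsets⁻ {k} u∈))))

      window-position-occupancy : ∀ {u} → u ∈ offsets k →
        (if y (- γ r + + u) then 1 else 0) ≡ sum (map (λ s → occupies s u) (allFin n))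
      window-position-occupancy {u} u∈ with y (- γ r + + u) in y[p]
      ... | true with window-occupant (Equivalence.to (tracks _) y[p]) (window-above-γ u∈) (window-below-L u∈)
      ...   | s , r<s , p≡ = sym (sum-map-single (Unique.allFin⁺ n) (∈-allFin s)
                (trans (when-yes (r Fin.<? s) r<s) (when-yes (- γ r + + u ≟ℤ - f s) p≡))
                λ {s'} _ s'≢s → when-zero (r Fin.<? s') λ _ → when-no (- γ r + + u ≟ℤ - f s') λ p≡' →
                  s'≢s (-f-injective (trans (sym p≡') p≡)))
      window-position-occupancy {u} u∈ | false = sym (sum-map-zero {xs = allFin n} λ {s} _ →
        when-zero (r Fin.<? s) λ r<s → when-no (- γ r + + u ≟ℤ - f s) λ p≡ →
          false≢true (trans (sym y[p]) (Equivalence.from (tracks _) (subst (Occupied t) (sym p≡) (later-occupied r<s)))))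
        where false≢true : false ≢ true
              false≢true ()

      occupancies-of-row : ∀ s → sum (map (occupies s) (offsets k)) ≡ when (r Fin.<? s) (𝟙 (f s <ℤ? f r))
      occupancies-of-row s = trans (sum-map-when (r Fin.<? s) (offsets k) _) (when-cong (r Fin.<? s) λ r<s →
        trans (offsets-hit k (- γ r) (- f s) (-f<-γ+k r<s)) (𝟙-resp-⇔ _ _ -γ<-f⇔f<f))
        where
          -f<-γ+k : toℕ r < toℕ s → - f s <ℤ - γ r + + k
          -f<-γ+k r<s = subst (- f s <ℤ_) (sym (-γ+k≡-L r)) (ℤP.neg-mono-< (L<later-f r<s))
          -γ<-f⇔f<f : - γ r <ℤ - f s ⇔ f s <ℤ f r
          -γ<-f⇔f<f = mk⇔ (λ h → subst (f s <ℤ_) (sym (f-reversed σr)) (ℤP.neg-cancel-< h))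
                          (λ h → ℤP.neg-mono-< (subst (f s <ℤ_) (f-reversed σr) h))

      window-count : window k y (γ r) ≡ laterSmaller f r
      window-count = begin
        sum (map (λ u → if y (- γ r + + u) then 1 else 0) (offsets k))
          ≡⟨ sum-map-cong window-position-occupancy ⟩
        sum (map (λ u → sum (map (λ s → occupies s u) (allFin n))) (offsets k))
          ≡⟨ sum-map-exchange (offsets k) (allFin n) (λ u s → occupies s u) ⟩
        sum (map (λ s → sum (map (occupies s) (offsets k))) (allFin n))
          ≡⟨ sum-map-cong {xs = allFin n} (λ {s} _ → occupancies-of-row s) ⟩
        laterSmaller f r ∎
        where open ≡-Reasoning

      -γ-unoccupied : ¬ Occupied t (- γ r)
      -γ-unoccupied (unmoved i i<t e) with FinP.<-cmp i r
      ... | tri< i<r _ _  = ℤP.<-irrefl (sym (ℤP.neg-injective e)) (ℤP.<-trans (L-strict i<r) (L<γ r))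
      ... | tri≈ _ refl _ = ℤP.<-irrefl (sym (ℤP.neg-injective e)) (L<γ r)
      ... | tri> _ _ r<i  = ℕP.<-irrefl (cong toℕ (-f-injective
              (trans (cong -_ (f-reversed σr)) (trans e (cong -_ (sym (f≡L-between r<i i<t))))))) r<i
      -γ-unoccupied (moved i t≤i e) =
        ℕP.<-irrefl (cong toℕ (-f-injective (trans (cong -_ (f-reversed σr)) e))) (ℕP.<-≤-trans r<t t≤i)
      -γ-unoccupied (deep -γ≤-n) = ℤP.<⇒≱ -n<-γ -γ≤-n

      -L-vacated : ¬ Occupied (toℕ r) (- L r)
      -L-vacated (unmoved i i<r e) = ℤP.<-irrefl (sym (ℤP.neg-injective e)) (L-strict i<r)
      -L-vacated (moved i r≤i e) with FinP.<-cmp r i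
      ... | tri< r<i _ _  = ℤP.<-irrefl (ℤP.neg-injective e) (L<later-f r<i)
      ... | tri≈ _ refl _ = ℤP.<-irrefl (trans (ℤP.neg-injective e) (f-reversed σr)) (L<γ r)
      ... | tri> _ _ i<r  = ℕP.<⇒≱ i<r r≤i
      -L-vacated (deep -L≤-n) = ℤP.<⇒≱ (ℤP.neg-mono-< (ℤP.≤-<-trans (L≤f r) (f<n r))) -L≤-n

      Occupied-t⇒r : ∀ {p} → p ≢ - L r → Occupied t p → Occupied (toℕ r) p
      Occupied-t⇒r p≢-L (unmoved i i<t e) with FinP.<-cmp i r
      ... | tri< i<r _ _  = unmoved i i<r e
      ... | tri≈ _ refl _ = ⊥-elim (p≢-L e)
      ... | tri> _ _ r<i  = moved i (ℕP.<⇒≤ r<i) (trans e (cong -_ (sym (f≡L-between r<i i<t))))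
      Occupied-t⇒r _ (moved i t≤i e) = moved i (ℕP.<⇒≤ (ℕP.<-≤-trans r<t t≤i)) e
      Occupied-t⇒r _ (deep p≤-n) = deep p≤-n

      Occupied-r⇒t : ∀ {p} → p ≢ - γ r → Occupied (toℕ r) p → Occupied t p
      Occupied-r⇒t _ (unmoved i i<r e) = unmoved i (ℕP.<-trans i<r r<t) e
      Occupied-r⇒t p≢-γ (moved i r≤i e) with toℕ i ℕ.<? t
      ... | no i≮t = moved i (ℕP.≮⇒≥ i≮t) e
      ... | yes i<t with FinP.<-cmp r i
      ...   | tri< r<i _ _  = unmoved i i<t (trans e (cong -_ (f≡L-between r<i i<t)))
      ...   | tri≈ _ refl _ = ⊥-elim (p≢-γ (trans e (cong -_ (f-reversed σr))))
      ...   | tri> _ _ i<r  = ⊥-elim (ℕP.<⇒≱ i<r r≤i)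
      Occupied-r⇒t _ (deep p≤-n) = deep p≤-n

      swap-tracks : Tracks (toℕ r) (swapAt y (- γ r) (- γ r + + k))
      swap-tracks p with p ≟ℤ - γ r | p ≟ℤ - γ r + + k
      ... | yes refl | _ =
        mk⇔ (λ _ → moved r ℕP.≤-refl (cong -_ (sym (f-reversed σr))))
            (λ _ → Equivalence.from (tracks _) (subst (Occupied t) (sym (-γ+k≡-L r)) (unmoved r r<t refl)))
      ... | no _ | yes refl =
        mk⇔ (λ y[-γ] → ⊥-elim (-γ-unoccupied (Equivalence.to (tracks _) y[-γ])))
            (λ occupied → ⊥-elim (-L-vacated (subst (Occupied (toℕ r)) (-γ+k≡-L r) occupied)))
      ... | no p≢-γ | no p≢-γ+k =
        mk⇔ (λ y[p] → Occupied-t⇒r (λ e → p≢-γ+k (trans e (sym (-γ+k≡-L r)))) (Equivalence.to (tracks p) y[p]))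
            (λ occupied → Equivalence.from (tracks p) (Occupied-r⇒t p≢-γ occupied))

    record EnumeratesReversedBelow (t : ℕ) (rs : List (Fin n)) : Set where
      field
        descending     : AllPairs (λ u v → toℕ v < toℕ u) rs
        reversed-below : ∀ {i} → i ∈ rs → σ i ≡ true × toℕ i < t
        complete       : ∀ {i} → σ i ≡ true → toℕ i < t → i ∈ rs

    htAux-sweep : ∀ {t y rs} → Tracks t y → EnumeratesReversedBelow t rs →
                  htAux k (map γ rs) y ≡ sum (map (laterSmaller f) rs)
    htAux-sweep {rs = []} _ _ = refl
    htAux-sweep {t} {y} {r ∷ rs} tracks enum =
      cong₂ ℕ._+_ (Swap.window-count tracks r<t σr between) (htAux-sweep (Swap.swap-tracks tracks r<t σr between) enum′)
      where
        open EnumeratesReversedBelow enum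
        r≻ : All.All (λ i → toℕ i < toℕ r) rs
        r≻ = AllPairs.head descending
        σr : σ r ≡ true
        σr = proj₁ (reversed-below (here refl))
        r<t : toℕ r < t
        r<t = proj₂ (reversed-below (here refl))
        between : UnreversedBetween r t
        between i r<i i<t with σ i in σi
        ... | false = refl
        ... | true with complete σi i<t
        ...   | here refl = ⊥-elim (ℕP.<-irrefl refl r<i)
        ...   | there i∈  = ⊥-elim (ℕP.<-asym r<i (All.lookup r≻ i∈))
        enum′ : EnumeratesReversedBelow (toℕ r) rs
        enum′ = record
          { descending     = AllPairs.tail descending
          ; reversed-below = λ i∈ → proj₁ (reversed-below (there i∈)) , All.lookup r≻ i∈
          ; complete       = λ {i} σi i<r → case-tail (complete σi (ℕP.<-trans i<r r<t)) i<r
          }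
          where
            case-tail : ∀ {i} → i ∈ r ∷ rs → toℕ i < toℕ r → i ∈ rs
            case-tail (here refl) i<r = ⊥-elim (ℕP.<-irrefl refl i<r)
            case-tail (there i∈)  _   = i∈

    private
      reversed? : ∀ i → Dec (σ i ≡ true)
      reversed? i = σ i Data.Bool.≟ true

    enumerates-reverse-reversedRows : EnumeratesReversedBelow n (reverse (reversedRows σ))
    enumerates-reverse-reversedRows = record
      { descending     = AllPairs-reverse (AllPairsₚ.filter⁺ reversed?
                           (AllPairsₚ.tabulate⁺-< {R = λ u v → toℕ u < toℕ v} {f = λ i → i} (λ i<j → i<j)))
      ; reversed-below = λ {i} i∈ →
          proj₂ (∈-filter⁻ reversed? {xs = allFin n} (∈-resp-↭ (↭-reverse (reversedRows σ)) i∈)) , FinP.toℕ<n i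
      ; complete       = λ {i} σi _ →
          ∈-resp-↭ (↭-sym (↭-reverse (reversedRows σ))) (∈-filter⁺ reversed? (∈-allFin i) σi)
      }

    inversions≡htAux : ∀ {x} → Tracks n x → inversionsℤ f ≡ htAux k (reverse (map γ (reversedRows σ))) x
    inversions≡htAux {x} tracks = begin
      sum (map (laterSmaller f) (allFin n))
        ≡⟨ sum-map-filter σ (laterSmaller f) (allFin n) (λ _ → laterSmaller-unreversed) ⟨
      sum (map (laterSmaller f) (reversedRows σ))
        ≡⟨ sum-↭ (map⁺ (laterSmaller f) (↭-sym (↭-reverse (reversedRows σ)))) ⟩
      sum (map (laterSmaller f) (reverse (reversedRows σ)))
        ≡⟨ htAux-sweep tracks enumerates-reverse-reversedRows ⟨
      htAux k (map γ (reverse (reversedRows σ))) x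
        ≡⟨ cong (λ γs → htAux k γs x) (List.reverse-map γ (reversedRows σ)) ⟩
      htAux k (reverse (map γ (reversedRows σ))) x ∎
      where
        open ≡-Reasoning

proposition6p7 : (k : ℕ) → 1 ≤ k → (λ' μ : List ℕ) → IsPartition λ' → IsPartition μ →
  (n : ℕ) → ℓ λ' ≤ n → ℓ μ < n →
  (a b : Fin n → ℕ) →
  (∀ i → InI μ n (a i) (rowStart λ' i)) →
  (∀ i → InI μ n (b i) (rowStart λ' i + + k)) →
  (σ : Orientation n) →
  map (cOf a b σ) (allFin n) ↭ upTo n →
  (x : ℤ → Bool) → (∀ p → (x p ≡ true) ⇔ MayaOne λ' p) →
  (size σ ≡ length (reversedRows σ)) × (inv (cOf a b σ) ≡ ht λ' k x σ)
proposition6p7 k 1≤k λ' μ (_ , λ-decreasing) (_ , μ-decreasing) n ℓλ≤n _ a b a∈I b∈I σ c-permutation x x-maya =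
  count-true≡length-filter σ (allFin n) , (begin
    inv c          ≡⟨ inv≡inversionsℤ c f (monotone-injective⇒<⇔< c-monotone c-injective) ⟩
    inversionsℤ f  ≡⟨ inversions≡htAux f-injective f<n tracks ⟩
    ht λ' k x σ    ∎)
  where
    open ≡-Reasoning
    open MayaSweep 1≤k (rowStart λ') (rowStart-strict λ-decreasing) σ
    c : Fin n → ℕ
    c = cOf a b σ
    c∈I : ∀ i → InI μ n (c i) (f i)
    c∈I i with σ i
    ... | true  = b∈I i
    ... | false = a∈I i
    c-monotone : ∀ {i j} → f i ≤ℤ f j → c i ≤ c j
    c-monotone = InI-index-mono μ-decreasing (c∈I _) (c∈I _)
    c-injective : ∀ {i j} → c i ≡ c j → i ≡ j
    c-injective = Unique-map⇒injective (Unique-resp-↭ (↭⇒↭ₛ (↭-sym c-permutation)) (Unique.upTo⁺ n))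
                    (∈-allFin _) (∈-allFin _)
    f-injective : ∀ {i j} → f i ≡ f j → i ≡ j
    f-injective = monotone-injective⇒injective c-monotone c-injective
    f<n : ∀ i → f i <ℤ + n
    f<n i = InI-<n (∈-upTo⁻ (∈-resp-↭ c-permutation (∈-map⁺ c (∈-allFin i)))) (c∈I i)
    tracks : Tracks f-injective f<n n x
    tracks p = ⇔-sym (Occupied-initial f-injective f<n p) ⇔-∘ (MayaOne⇔rowStart λ' ℓλ≤n p ⇔-∘ x-maya p)
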